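{- Let $G$ be a multigraph that has no perfect matching and admits an interval coloring. Then $w(G)\geq \max\{\Delta(G),2\delta(G)\}$.
   Context: Multigraphs are finite and may have multiple edges but no loops. For a positive integer $t$, an interval $t$-coloring of a multigraph $G$ is a proper edge coloring $\alpha:E(G)\to\{1,\dots,t\}$ in which every color $1,\dots,t$ is used and, for every vertex $v$, the set of colors on the edges incident to $v$ is an interval of consecutive integers. For a multigraph $G$ having an interval coloring, $w(G)$ denotes the minimum $t$ such that $G$ has an interval $t$-coloring. $\Delta(G)$ and $\delta(G)$ are the maximum and minimum degree. -}

module Defs where

open import Data.Nat using (ℕ; zero; suc; _≤_; _⊔_; _⊓_)
open import Data.Fin using (Fin)
import Data.Fin as F
open import Data.List using (List; []; _∷_; foldr; map)
open import Data.List.Base using (allFin)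
open import Data.Product using (Σ; ∃; _×_; _,_)
open import Data.Sum using (_⊎_)
open import Data.Bool using (Bool; true)
open import Relation.Nullary using (¬_; Dec; yes; no)
open import Relation.Binary.PropositionalEquality using (_≡_)
open import Data.Sum using (inj₁; inj₂)

-- A finite loopless multigraph: vertex set Fin n, edge set Fin m,
-- each edge e has two distinct endpoints; parallel edges allowed.
record Multigraph : Set where
  field
    n     : ℕ
    m     : ℕ
    end₁  : Fin m → Fin n
    end₂  : Fin m → Fin n
    loopless : ∀ e → ¬ (end₁ e ≡ end₂ e)

module _ (G : Multigraph) where
  open Multigraph G

  Incident : Fin m → Fin n → Set
  Incident e v = (end₁ e ≡ v) ⊎ (end₂ e ≡ v)

  incident? : ∀ e v → Dec (Incident e v)
  incident? e v with end₁ e F.≟ v | end₂ e F.≟ v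
  ... | yes p | _ = yes (inj₁ p)
  ... | no _ | yes q = yes (inj₂ q)
  ... | no p | no q = no λ { (inj₁ x) → p x ; (inj₂ y) → q y }

  -- number of edges incident to v (no loops, so this is the degree)
  countInc : Fin n → List (Fin m) → ℕ
  countInc v [] = 0
  countInc v (e ∷ es) with incident? e v
  ... | yes _ = suc (countInc v es)
  ... | no _ = countInc v es

  degree : Fin n → ℕ
  degree v = countInc v (allFin m)

  -- maximum degree Δ(G) (0 for the graph with no vertices)
  maxDegree : ℕ
  maxDegree = foldr _⊔_ 0 (map degree (allFin n))

  -- minimum degree δ(G) (0 for the graph with no vertices)
  minDegree : ℕ
  minDegree with n | degree
  ... | zero  | _ = 0
  ... | suc k | d = foldr _⊓_ (d F.zero) (map d (allFin (suc k)))

  HasPerfectMatching : Set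
  HasPerfectMatching =
    Σ (Fin m → Bool) λ M → ∀ v →
      ∃ λ e → (M e ≡ true) × Incident e v ×
        (∀ e' → M e' ≡ true → Incident e' v → e' ≡ e)

  IsIntervalColoring : ℕ → (Fin m → ℕ) → Set
  IsIntervalColoring t α =
    (∀ e → (1 ≤ α e) × (α e ≤ t)) ×
    (∀ e e' v → ¬ (e ≡ e') → Incident e v → Incident e' v → ¬ (α e ≡ α e')) ×
    (∀ c → 1 ≤ c → c ≤ t → ∃ λ e → α e ≡ c) ×
    -- at every vertex the colors form an interval of consecutive integers
    (∀ v e e' c → Incident e v → Incident e' v → α e ≤ c → c ≤ α e' →
       ∃ λ e'' → Incident e'' v × (α e'' ≡ c))

  HasIntervalColoring : ℕ → Set
  HasIntervalColoring t = Σ (Fin m → ℕ) (IsIntervalColoring t)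

  IntervalColorable : Set
  IntervalColorable = ∃ HasIntervalColoring

  -- "w(G) ≥ k": every t for which G has an interval t-coloring is ≥ k,
  -- i.e. the minimum such t is ≥ k
  wAtLeast : ℕ → Set
  wAtLeast k = ∀ t → HasIntervalColoring t → k ≤ t

module Submission where

-- The colours at a vertex v are pairwise distinct (properness), so
-- if they all lie in a window [lo, lo + k) then d(v) ≤ k (a counting lemma,
-- proved by injecting the edges at v into Fin k).  With the window [1, t]
-- this gives d(v) ≤ t for every v, hence Δ(G) ≤ t.  Suppose t < 2c where
-- c = δ(G).  For every vertex v, d(v) ≥ c > t ∸ c, so by the counting lemma
-- v has an edge of colour ≤ c, and d(v) > c - 1, so v has an edge of colour
-- ≥ c; as the colours at v form an interval, v has an edge of colour
-- exactly c.  By properness the colour class c then meets every vertex in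
-- exactly one edge: it is a perfect matching, contradicting the hypothesis.

open import Defs
open import Data.Nat
  using (ℕ; zero; suc; _≤_; _<_; _+_; _*_; _∸_; _⊔_; _⊓_; z≤n; s≤s; _≤?_; _<?_; _≡ᵇ_)
open import Data.Nat.Properties
  using (≤-trans; ≤-reflexive; <-≤-trans; ≰⇒>; ≮⇒≥; <⇒≱; ⊔-lub; m⊓n≤m; m⊓n≤n; +-identityʳ;
         ∸-monoˡ-<; ∸-cancelʳ-≡; m+n∸m≡n; m≤n+m∸n; m<n+o⇒m∸n<o; ≡ᵇ⇒≡; ≡⇒≡ᵇ)
open import Data.Fin as F using (Fin; fromℕ<; _≟_)
open import Data.Fin.Properties using (fromℕ<-injective; injective⇒≤; any?)
open import Data.List using (List; []; _∷_; foldr; map; allFin)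
open import Data.List.Membership.Propositional using (_∈_)
open import Data.List.Membership.Propositional.Properties using (∈-allFin)
open import Data.List.Relation.Unary.Any using (here; there)
open import Data.List.Relation.Unary.All using (lookup)
open import Data.List.Relation.Unary.AllPairs using (_∷_)
open import Data.List.Relation.Unary.Unique.Propositional using (Unique)
open import Data.List.Relation.Unary.Unique.Propositional.Properties using (allFin⁺)
open import Data.Product using (∃; _×_; _,_; proj₁; proj₂)
open import Data.Bool using (Bool; true)
open import Data.Bool.Properties using (T-≡)
open import Data.Empty using (⊥-elim)
open import Function.Bundles using (Equivalence)
open import Relation.Nullary using (¬_; yes; no; contradiction)
open import Relation.Nullary.Decidable using (_×-dec_)
open import Relation.Binary.PropositionalEquality using (_≡_; refl; sym; trans; cong)

module _ (G : Multigraph) where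
  open Multigraph G

  edgeAt : ∀ v (es : List (Fin m)) → Fin (countInc G v es) → Fin m
  edgeAt v (e ∷ es) i with incident? G e v
  edgeAt v (e ∷ es) F.zero    | yes _ = e
  edgeAt v (e ∷ es) (F.suc i) | yes _ = edgeAt v es i
  edgeAt v (e ∷ es) i         | no _  = edgeAt v es i

  edgeAt-incident : ∀ v es i → Incident G (edgeAt v es i) v
  edgeAt-incident v (e ∷ es) i with incident? G e v
  edgeAt-incident v (e ∷ es) F.zero    | yes e∼v = e∼v
  edgeAt-incident v (e ∷ es) (F.suc i) | yes _   = edgeAt-incident v es i
  edgeAt-incident v (e ∷ es) i         | no _    = edgeAt-incident v es i

  edgeAt-∈ : ∀ v es i → edgeAt v es i ∈ es
  edgeAt-∈ v (e ∷ es) i with incident? G e v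
  edgeAt-∈ v (e ∷ es) F.zero    | yes _ = here refl
  edgeAt-∈ v (e ∷ es) (F.suc i) | yes _ = there (edgeAt-∈ v es i)
  edgeAt-∈ v (e ∷ es) i         | no _  = there (edgeAt-∈ v es i)

  edgeAt-injective : ∀ v es → Unique es → ∀ i j → edgeAt v es i ≡ edgeAt v es j → i ≡ j
  edgeAt-injective v (e ∷ es) (e∉es ∷ u) i j eq with incident? G e v
  ... | no _ = edgeAt-injective v es u i j eq
  edgeAt-injective v (e ∷ es) (e∉es ∷ u) F.zero    F.zero    eq | yes _ = refl
  edgeAt-injective v (e ∷ es) (e∉es ∷ u) F.zero    (F.suc j) eq | yes _ =
    ⊥-elim (lookup e∉es (edgeAt-∈ v es j) eq)
  edgeAt-injective v (e ∷ es) (e∉es ∷ u) (F.suc i) F.zero    eq | yes _ =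
    ⊥-elim (lookup e∉es (edgeAt-∈ v es i) (sym eq))
  edgeAt-injective v (e ∷ es) (e∉es ∷ u) (F.suc i) (F.suc j) eq | yes _ =
    cong F.suc (edgeAt-injective v es u i j eq)

  Proper : (Fin m → ℕ) → Set
  Proper α = ∀ e e' v → ¬ (e ≡ e') → Incident G e v → Incident G e' v → ¬ (α e ≡ α e')

  proper-injective : ∀ {α} → Proper α → ∀ {e e' v} →
                     Incident G e v → Incident G e' v → α e ≡ α e' → e ≡ e'
  proper-injective pr {e} {e'} {v} e∼v e'∼v same with e ≟ e'
  ... | yes e≡e' = e≡e'
  ... | no  e≢e' = contradiction same (pr e e' v e≢e' e∼v e'∼v)

  -- Counting lemma: if the colours at v lie in the window [lo, lo + k),
  -- then d(v) ≤ k, since e ↦ α e ∸ lo injects the edges at v into Fin k.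
  degree≤window : ∀ {α} → Proper α → ∀ v lo k →
                  (∀ e → Incident G e v → (lo ≤ α e) × (α e < lo + k)) → degree G v ≤ k
  degree≤window {α} pr v lo k window = injective⇒≤ {f = slot} slot-injective
    where
      edge : Fin (degree G v) → Fin m
      edge = edgeAt v (allFin m)

      edge∼v : ∀ i → Incident G (edge i) v
      edge∼v i = edgeAt-incident v (allFin m) i

      lo≤ : ∀ i → lo ≤ α (edge i)
      lo≤ i = proj₁ (window (edge i) (edge∼v i))

      offset< : ∀ i → α (edge i) ∸ lo < k
      offset< i = ≤-trans (∸-monoˡ-< (proj₂ (window (edge i) (edge∼v i))) (lo≤ i))
                          (≤-reflexive (m+n∸m≡n lo k))

      slot : Fin (degree G v) → Fin k
      slot i = fromℕ< (offset< i)

      slot-injective : ∀ {i j} → slot i ≡ slot j → i ≡ j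
      slot-injective {i} {j} eq =
        edgeAt-injective v (allFin m) (allFin⁺ m) i j
          (proper-injective pr (edge∼v i) (edge∼v j)
            (∸-cancelʳ-≡ (lo≤ i) (lo≤ j) (fromℕ<-injective _ _ (offset< i) (offset< j) eq)))

  colourClass-perfectMatching : ∀ {α} → Proper α → ∀ c →
    (∀ v → ∃ λ e → Incident G e v × (α e ≡ c)) → HasPerfectMatching G
  colourClass-perfectMatching {α} pr c meets = inClass , matched
    where
      inClass : Fin m → Bool
      inClass e = α e ≡ᵇ c

      inClass⇒≡ : ∀ {e} → inClass e ≡ true → α e ≡ c
      inClass⇒≡ {e} isIn = ≡ᵇ⇒≡ (α e) c (Equivalence.from T-≡ isIn)

      matched : ∀ v → ∃ λ e → (inClass e ≡ true) × Incident G e v ×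
                  (∀ e' → inClass e' ≡ true → Incident G e' v → e' ≡ e)
      matched v with meets v
      ... | e , e∼v , αe≡c =
        e , Equivalence.to T-≡ (≡⇒≡ᵇ (α e) c αe≡c) , e∼v ,
        λ e' isIn e'∼v → proper-injective pr e'∼v e∼v (trans (inClass⇒≡ isIn) (sym αe≡c))

  maxDegree≤ : ∀ t → (∀ v → degree G v ≤ t) → maxDegree G ≤ t
  maxDegree≤ t bound = foldr-bound (allFin n)
    where
      foldr-bound : ∀ vs → foldr _⊔_ 0 (map (degree G) vs) ≤ t
      foldr-bound []       = z≤n
      foldr-bound (v ∷ vs) = ⊔-lub (bound v) (foldr-bound vs)

  module _ {t α} (interval : IsIntervalColoring G t α) where
    interval-proper : Proper α
    interval-proper = proj₁ (proj₂ interval)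

    private
      colour≥1 : ∀ e → 1 ≤ α e
      colour≥1 e = proj₁ (proj₁ interval e)

      colour≤t : ∀ e → α e ≤ t
      colour≤t e = proj₂ (proj₁ interval e)

      colours-form-interval : ∀ v e e' c → Incident G e v → Incident G e' v →
                              α e ≤ c → c ≤ α e' → ∃ λ e'' → Incident G e'' v × (α e'' ≡ c)
      colours-form-interval = proj₂ (proj₂ (proj₂ interval))

    degree≤t : ∀ v → degree G v ≤ t
    degree≤t v = degree≤window interval-proper v 1 t (λ e _ → colour≥1 e , s≤s (colour≤t e))

    -- If d(v) > t ∸ c, some edge at v has colour ≤ c; otherwise the colours
    -- at v would lie in the window [c + 1, t], of length t ∸ c.
    someColour≤ : ∀ v c → t ∸ c < degree G v → ∃ λ e → Incident G e v × (α e ≤ c)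
    someColour≤ v c large with any? (λ e → incident? G e v ×-dec (α e ≤? c))
    ... | yes found = found
    ... | no  none  = contradiction (degree≤window interval-proper v (suc c) (t ∸ c) window) (<⇒≱ large)
      where
        window : ∀ e → Incident G e v → (suc c ≤ α e) × (α e < suc c + (t ∸ c))
        window e e∼v = ≰⇒> (λ αe≤c → none (e , e∼v , αe≤c)) ,
                       s≤s (≤-trans (colour≤t e) (m≤n+m∸n t c))

    -- If d(v) > k, some edge at v has colour > k; otherwise the colours at v
    -- would lie in the window [1, k].
    someColour> : ∀ v k → k < degree G v → ∃ λ e → Incident G e v × (k < α e)
    someColour> v k large with any? (λ e → incident? G e v ×-dec (k <? α e))
    ... | yes found = found
    ... | no  none  = contradiction (degree≤window interval-proper v 1 k window) (<⇒≱ large)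
      where
        window : ∀ e → Incident G e v → (1 ≤ α e) × (α e < 1 + k)
        window e e∼v = colour≥1 e , s≤s (≮⇒≥ (λ k<αe → none (e , e∼v , k<αe)))

    -- If t < 2c and d(v) ≥ c, then v has an edge of colour exactly c: it has
    -- one of colour ≤ c and one of colour ≥ c, and its colours form an interval.
    seesColour : ∀ v c → t < c + c → c ≤ degree G v → ∃ λ e → Incident G e v × (α e ≡ c)
    seesColour v zero    () _
    seesColour v (suc k) t<2c c≤d
      with someColour≤ v (suc k) (<-≤-trans (m<n+o⇒m∸n<o t (suc k) t<2c) c≤d)
         | someColour> v k c≤d
    ... | e₁ , e₁∼v , αe₁≤c | e₂ , e₂∼v , c≤αe₂ =
      colours-form-interval v e₁ e₂ (suc k) e₁∼v e₂∼v αe₁≤c c≤αe₂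

minDegree≤degree : (G : Multigraph) → ∀ v → minDegree G ≤ degree G v
minDegree≤degree record { n = zero } ()
minDegree≤degree G@record { n = suc k } v = foldr-bound (allFin (suc k)) (∈-allFin v)
  where
    foldr-bound : ∀ vs → v ∈ vs → foldr _⊓_ (degree G F.zero) (map (degree G) vs) ≤ degree G v
    foldr-bound (u ∷ us) (here refl) = m⊓n≤m (degree G u) _
    foldr-bound (u ∷ us) (there v∈us) = ≤-trans (m⊓n≤n (degree G u) _) (foldr-bound us v∈us)

mainTheorem17 : (G : Multigraph) → ¬ HasPerfectMatching G → IntervalColorable G →
    wAtLeast G (maxDegree G ⊔ (2 * minDegree G))
mainTheorem17 G noMatching _ t (α , interval) =
  ⊔-lub (maxDegree≤ G t (degree≤t G interval)) 2δ≤t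
  where
    δ : ℕ
    δ = minDegree G

    -- If t < 2δ, the colour class δ would be a perfect matching.
    2δ≤t : 2 * δ ≤ t
    2δ≤t with 2 * δ ≤? t
    ... | yes 2δ≤t = 2δ≤t
    ... | no  2δ≰t = contradiction (colourClass-perfectMatching G (interval-proper G interval) δ
                       (λ v → seesColour G interval v δ t<δ+δ (minDegree≤degree G v))) noMatching
      where
        t<δ+δ : t < δ + δ
        t<δ+δ = <-≤-trans (≰⇒> 2δ≰t) (≤-reflexive (cong (δ +_) (+-identityʳ δ)))
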